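{- For every positive integer $n$, letting $2\mathbb{N}$ denote the set of even positive integers, $$\frac{n!\left(\lceil n/2\rceil+1\right)}{2\binom{n}{\lfloor n/2\rfloor}}\le T(n,2\mathbb{N})\le \frac{n!}{2^{\lfloor n/2\rfloor}}.$$
   Context: Here $\mathbb{N}=\{1,2,3,\dots\}$ and $[n]=\{1,\dots,n\}$. For $D\subseteq\mathbb{N}$, two permutations $\pi,\sigma$ of $[n]$ are called $G(D)$-different if there is a position $i\in[n]$ with $|\pi(i)-\sigma(i)|\in D$. $T(n,D)$ denotes the maximum cardinality of a set of permutations of $[n]$ any two distinct members of which are $G(D)$-different. -}

module Defs where

open import Data.Nat using (ℕ; suc; _*_; ∣_-_∣; _≤_)
open import Data.Fin using (Fin; toℕ)
open import Data.Fin.Permutation using (Permutation′; _⟨$⟩ʳ_)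
open import Data.List using (List; length)
open import Data.List.Relation.Unary.AllPairs using (AllPairs)
open import Data.Product using (Σ; ∃; _×_)
open import Relation.Binary.PropositionalEquality using (_≡_)

Even⁺ : ℕ → Set
Even⁺ d = ∃ λ k → d ≡ 2 * suc k

GDifferent : (n : ℕ) → (ℕ → Set) → Permutation′ n → Permutation′ n → Set
GDifferent n D π σ =
  Σ (Fin n) λ i → D ∣ toℕ (π ⟨$⟩ʳ i) - toℕ (σ ⟨$⟩ʳ i) ∣

-- A family of permutations of [n] (listed), any two members at distinct
-- positions of the list being G(D)-different.  (Since 0 ∉ D for the D used,
-- the listed permutations are automatically pairwise distinct, so the length
-- of the list is the cardinality of the set.)
GDFamily : (n : ℕ) → (ℕ → Set) → List (Permutation′ n) → Set
GDFamily n D ps = AllPairs (GDifferent n D) ps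

IsT : (n : ℕ) → (ℕ → Set) → ℕ → Set
IsT n D t =
  (Σ (List (Permutation′ n)) λ ps → GDFamily n D ps × length ps ≡ t) ×
  ((ps : List (Permutation′ n)) → GDFamily n D ps → length ps ≤ t)

module Submission where

-- Two permutations are G(2ℕ)-different exactly when at some position their
-- values are distinct and of the same parity.
--
-- Let s choose, for each of the ⌊n/2⌋ pairs {2q,2q+1}, whether to
-- exchange its two values, and let π·s be π followed by these exchanges.  For π
-- in a G(2ℕ)-family the 2^⌊n/2⌋ permutations π·s are distinct, and π·s = π'·s'
-- forces π, π' to put values of the same pair at every position, so π = π'.
-- Hence (family size)·2^⌊n/2⌋ ≤ n!.
--
-- For n ≥ 2 let E be the ⌈n/2⌉ even values together with the value
-- 1.  Take an even permutation ρ of E followed by an arbitrary permutation σ of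
-- the ⌊n/2⌋ odd values.  If two such permutations are nowhere at an even
-- positive distance, the odd positions force σ = σ', and then ρ, ρ' can only
-- differ by exchanging the value 1 with one other value; that transposition
-- changes the parity, so ρ = ρ'.  This family has ⌊n/2⌋!·(⌈n/2⌉+1)!/2
-- members, which is the stated bound.  For n ≤ 1 one permutation suffices.

open import Defs
open import Data.Nat
  using (ℕ; zero; suc; _+_; _*_; _∸_; _^_; _!; _≤_; _<ᵇ_; ⌊_/2⌋; ⌈_/2⌉; ∣_-_∣; NonZero)
open import Data.Nat.Properties
  using (*-suc; *-distribˡ-∣-∣; ∣m-n∣≡0⇒m≡n; *-monoʳ-≤; ≤-trans; m≤m+n; m+n∸m≡n;
         ⌊n/2⌋+⌈n/2⌉≡n; _!*_!≢0; module ≤-Reasoning)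
open import Data.Nat.Combinatorics using (_C_; nCk≡n!/k![n-k]!; k![n∸k]!∣n!)
open import Data.Nat.DivMod using (m/n*n≡m)
open import Data.Nat.Solver using (module +-*-Solver)
open import Data.Bool using (Bool; true; false; _xor_)
open import Data.Bool.Properties using (xor-same)
open import Data.Bool.Solver using (module xor-∧-Solver)
open import Data.Empty using (⊥-elim)
open import Data.Fin using (Fin; zero; suc; toℕ; _≟_; _↑ˡ_; quotient; remainder; combine; punchIn)
open import Data.Fin.Properties
  using (toℕ-injective; suc-injective; 0≢1+n; combine-remQuot; combine-injective; injective⇒≤; any?)
open import Data.Fin.Permutation
  using (Permutation′; _⟨$⟩ʳ_; _⟨$⟩ˡ_; inverseˡ; inverseʳ; _≈_; id; lift₀; transpose; _∘ₚ_;
         remove; punchIn-permute)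
import Data.Fin.Permutation.Components as PC
open import Data.List using (List; []; _∷_; length; lookup; tabulate; map)
open import Data.List.Properties using (tabulate-cong; map-tabulate; length-tabulate)
open import Data.List.Relation.Unary.All using (All; []; _∷_)
open import Data.List.Relation.Unary.AllPairs using (AllPairs; []; _∷_)
open import Data.List.Relation.Unary.AllPairs.Properties using (tabulate⁺)
open import Data.Product using (Σ; _×_; _,_)
open import Data.Sum using (_⊎_; inj₁; inj₂)
import Data.Sum as Sum
open import Function using (_∘_; _↔_; Inverse; mk↔ₛ′)
open import Function.Construct.Composition using (_↔-∘_)
open import Function.Construct.Identity using (↔-id)
open import Function.Construct.Symmetry using (↔-sym)
open import Relation.Binary.PropositionalEquality
open import Relation.Nullary using (¬_; Dec; yes; no)
import Relation.Nullary.Decidable as Decidable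

¬even⁺-0 : ¬ Even⁺ 0
¬even⁺-0 (_ , ())

¬even⁺-1 : ¬ Even⁺ 1
¬even⁺-1 (zero , ())
¬even⁺-1 (suc _ , ())

-- Being an even positive integer is decidable; this lets us find a witness
-- position once "no position is at an even positive distance" is refuted.
even⁺? : (d : ℕ) → Dec (Even⁺ d)
even⁺? zero = no ¬even⁺-0
even⁺? (suc zero) = no ¬even⁺-1
even⁺? (suc (suc zero)) = yes (zero , refl)
even⁺? (suc (suc (suc d))) = Decidable.map′ up down (even⁺? (suc d))
  where
  up : Even⁺ (suc d) → Even⁺ (suc (suc (suc d)))
  up (k , e) = suc k , trans (cong (2 +_) e) (sym (*-suc 2 (suc k)))
  down : Even⁺ (suc (suc (suc d))) → Even⁺ (suc d)
  down (zero , ())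
  down (suc k , e) = k , cong (_∸ 2) (trans e (*-suc 2 (suc k)))

even⁺-double-distance : ∀ {a b} → a ≢ b → Even⁺ ∣ 2 * a - 2 * b ∣
even⁺-double-distance {a} {b} a≢b with ∣ a - b ∣ in eq
... | zero = ⊥-elim (a≢b (∣m-n∣≡0⇒m≡n eq))
... | suc k = k , trans (sym (*-distribˡ-∣-∣ 2 a b)) (cong (2 *_) eq)

same-pair⇒¬even⁺ : ∀ x y → ⌊ x /2⌋ ≡ ⌊ y /2⌋ → ¬ Even⁺ ∣ x - y ∣
same-pair⇒¬even⁺ zero zero _ = ¬even⁺-0
same-pair⇒¬even⁺ zero (suc zero) _ = ¬even⁺-1
same-pair⇒¬even⁺ (suc zero) zero _ = ¬even⁺-1
same-pair⇒¬even⁺ (suc zero) (suc zero) _ = ¬even⁺-0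
same-pair⇒¬even⁺ zero (suc (suc y)) ()
same-pair⇒¬even⁺ (suc zero) (suc (suc y)) ()
same-pair⇒¬even⁺ (suc (suc x)) zero ()
same-pair⇒¬even⁺ (suc (suc x)) (suc zero) ()
same-pair⇒¬even⁺ (suc (suc x)) (suc (suc y)) e = same-pair⇒¬even⁺ x y (cong Data.Nat.pred e)

smallerParity : ℕ → List ℕ → Bool
smallerParity a [] = false
smallerParity a (y ∷ l) = (y <ᵇ a) xor smallerParity a l

inversionParity : List ℕ → Bool
inversionParity [] = false
inversionParity (y ∷ l) = smallerParity y l xor inversionParity l

<ᵇ-xor-≢ : ∀ a b → a ≢ b → (a <ᵇ b) xor (b <ᵇ a) ≡ true
<ᵇ-xor-≢ zero zero a≢b = ⊥-elim (a≢b refl)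
<ᵇ-xor-≢ zero (suc b) _ = refl
<ᵇ-xor-≢ (suc a) zero _ = refl
<ᵇ-xor-≢ (suc a) (suc b) a≢b = <ᵇ-xor-≢ a b (a≢b ∘ cong suc)

data Replace (a b : ℕ) : List ℕ → List ℕ → Set where
  here  : ∀ l → Replace a b (a ∷ l) (b ∷ l)
  there : ∀ {y l l'} → y ≢ a → y ≢ b → Replace a b l l' → Replace a b (y ∷ l) (y ∷ l')

smallerParity-replace : ∀ {a b l l'} → Replace a b l l' → ∀ z →
  smallerParity z l' ≡ (smallerParity z l xor (a <ᵇ z)) xor (b <ᵇ z)
smallerParity-replace {a} {b} (here l) z =
  solve 3 (λ A B S → B :+ S := ((A :+ S) :+ A) :+ B) refl (a <ᵇ z) (b <ᵇ z) (smallerParity z l)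
  where open xor-∧-Solver
smallerParity-replace {a} {b} (there {y} {l} _ _ p) z rewrite smallerParity-replace p z =
  solve 4 (λ Y S A B → Y :+ ((S :+ A) :+ B) := ((Y :+ S) :+ A) :+ B) refl
    (y <ᵇ z) (smallerParity z l) (a <ᵇ z) (b <ᵇ z)
  where open xor-∧-Solver

-- Exchanging the head b of  b ∷ l  with the entry a of l flips the inversion
-- parity.  Induction on the position of a: each entry y in between forms an
-- inversion with exactly one of a, b on either side, so its contributions cancel.
replace-flips : ∀ {a b l l'} → Replace a b l l' → a ≢ b →
  inversionParity (b ∷ l) xor inversionParity (a ∷ l') ≡ true
replace-flips {a} {b} (here q) a≢b = begin
  inversionParity (b ∷ a ∷ q) xor inversionParity (a ∷ b ∷ q)
    ≡⟨ solve 5 (λ AB BA Bq Aq I → ((AB :+ Bq) :+ (Aq :+ I)) :+ ((BA :+ Aq) :+ (Bq :+ I)) := AB :+ BA)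
         refl
         (a <ᵇ b) (b <ᵇ a) (smallerParity b q) (smallerParity a q) (inversionParity q) ⟩
  (a <ᵇ b) xor (b <ᵇ a)
    ≡⟨ <ᵇ-xor-≢ a b a≢b ⟩
  true ∎
  where open ≡-Reasoning; open xor-∧-Solver
replace-flips {a} {b} (there {y} {r} {r'} y≢a y≢b p) a≢b = begin
  left xor (((y <ᵇ a) xor smallerParity a r') xor (smallerParity y r' xor inversionParity r'))
    ≡⟨ cong (λ s → left xor (((y <ᵇ a) xor smallerParity a r') xor (s xor inversionParity r')))
         (smallerParity-replace p y) ⟩
  left xor (((y <ᵇ a) xor smallerParity a r')
           xor (((smallerParity y r xor (a <ᵇ y)) xor (b <ᵇ y)) xor inversionParity r'))
    ≡⟨ solve 9 (λ YB BY YA AY BR AR' YR IR IR' →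
          ((YB :+ BR) :+ (YR :+ IR)) :+ ((YA :+ AR') :+ (((YR :+ AY) :+ BY) :+ IR'))
          := (YB :+ BY) :+ ((YA :+ AY) :+ ((BR :+ IR) :+ (AR' :+ IR')))) refl
         (y <ᵇ b) (b <ᵇ y) (y <ᵇ a) (a <ᵇ y) (smallerParity b r) (smallerParity a r')
         (smallerParity y r) (inversionParity r) (inversionParity r') ⟩
  ((y <ᵇ b) xor (b <ᵇ y))
    xor (((y <ᵇ a) xor (a <ᵇ y)) xor (inversionParity (b ∷ r) xor inversionParity (a ∷ r')))
    ≡⟨ cong₂ _xor_ (<ᵇ-xor-≢ y b y≢b) (cong₂ _xor_ (<ᵇ-xor-≢ y a y≢a) (replace-flips p a≢b)) ⟩
  true ∎
  where
  open ≡-Reasoning; open xor-∧-Solver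
  left = inversionParity (b ∷ y ∷ r)

data Swap : List ℕ → List ℕ → Set where
  here  : ∀ {a x r r'} → a ≢ x → Replace x a r r' → Swap (a ∷ r) (x ∷ r')
  there : ∀ {y r r'} → Swap r r' → Swap (y ∷ r) (y ∷ r')

smallerParity-swap : ∀ {l l'} → Swap l l' → ∀ z → smallerParity z l' ≡ smallerParity z l
smallerParity-swap (here {a} {x} {r} _ p) z rewrite smallerParity-replace p z =
  solve 3 (λ X S A → X :+ ((S :+ X) :+ A) := A :+ S) refl (x <ᵇ z) (smallerParity z r) (a <ᵇ z)
  where open xor-∧-Solver
smallerParity-swap (there {y} p) z = cong ((y <ᵇ z) xor_) (smallerParity-swap p z)

swap-flips : ∀ {l l'} → Swap l l' → inversionParity l xor inversionParity l' ≡ true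
swap-flips (here a≢x p) = replace-flips p (a≢x ∘ sym)
swap-flips (there {y} {r} {r'} p) = begin
  (smallerParity y r xor inversionParity r) xor (smallerParity y r' xor inversionParity r')
    ≡⟨ cong (λ s → (smallerParity y r xor inversionParity r) xor (s xor inversionParity r'))
         (smallerParity-swap p y) ⟩
  (smallerParity y r xor inversionParity r) xor (smallerParity y r xor inversionParity r')
    ≡⟨ solve 3 (λ S I I' → (S :+ I) :+ (S :+ I') := I :+ I') refl
         (smallerParity y r) (inversionParity r) (inversionParity r') ⟩
  inversionParity r xor inversionParity r'
    ≡⟨ swap-flips p ⟩
  true ∎
  where open ≡-Reasoning; open xor-∧-Solver

values : ∀ {k} → Permutation′ k → List ℕ
values ρ = tabulate (λ i → toℕ (ρ ⟨$⟩ʳ i))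

parity : ∀ {k} → Permutation′ k → Bool
parity ρ = inversionParity (values ρ)

parity-cong : ∀ {k} {ρ ρ' : Permutation′ k} → ρ ≈ ρ' → parity ρ ≡ parity ρ'
parity-cong ρ≈ρ' = cong inversionParity (tabulate-cong (cong toℕ ∘ ρ≈ρ'))

⟨$⟩ʳ-injective : ∀ {k} (ρ : Permutation′ k) {i j} → ρ ⟨$⟩ʳ i ≡ ρ ⟨$⟩ʳ j → i ≡ j
⟨$⟩ʳ-injective ρ {i} {j} e = trans (sym (inverseˡ ρ)) (trans (cong (ρ ⟨$⟩ˡ_) e) (inverseˡ ρ))

⟨$⟩ʳ≡⇒≡⟨$⟩ˡ : ∀ {k} (ρ : Permutation′ k) {i v} → ρ ⟨$⟩ʳ i ≡ v → i ≡ ρ ⟨$⟩ˡ v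
⟨$⟩ʳ≡⇒≡⟨$⟩ˡ ρ e = trans (sym (inverseˡ ρ)) (cong (ρ ⟨$⟩ˡ_) e)

tabulate-replace : ∀ {k} (f g : Fin k → ℕ) (c : Fin k) {a b} → f c ≡ a → g c ≡ b →
  (∀ i → i ≢ c → g i ≡ f i) → (∀ i → i ≢ c → f i ≢ a) → (∀ i → i ≢ c → f i ≢ b) →
  Replace a b (tabulate f) (tabulate g)
tabulate-replace f g zero refl refl agree _ _
  rewrite tabulate-cong {f = g ∘ suc} {g = f ∘ suc} (λ i → agree (suc i) (λ ())) = here _
tabulate-replace f g (suc c) fc gc agree ≢a ≢b rewrite agree zero (λ ()) =
  there (≢a zero (λ ())) (≢b zero (λ ()))
    (tabulate-replace (f ∘ suc) (g ∘ suc) c fc gc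
      (λ i i≢c → agree (suc i) (i≢c ∘ suc-injective))
      (λ i i≢c → ≢a (suc i) (i≢c ∘ suc-injective))
      (λ i i≢c → ≢b (suc i) (i≢c ∘ suc-injective)))

tabulate-swap : ∀ {k} (f g : Fin k → ℕ) (b c : Fin k) → b ≢ c → g b ≡ f c → g c ≡ f b →
  (∀ i → i ≢ b → i ≢ c → g i ≡ f i) → (∀ {i j} → f i ≡ f j → i ≡ j) →
  Swap (tabulate f) (tabulate g)
tabulate-swap f g zero zero b≢c _ _ _ _ = ⊥-elim (b≢c refl)
tabulate-swap f g zero (suc c) _ gb gc agree inj rewrite gb =
  here (λ e → 0≢1+n (inj e))
    (tabulate-replace (f ∘ suc) (g ∘ suc) c refl gc
      (λ i i≢c → agree (suc i) (λ ()) (i≢c ∘ suc-injective))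
      (λ i i≢c e → i≢c (suc-injective (inj e)))
      (λ i i≢c e → 0≢1+n (inj (sym e))))
tabulate-swap f g (suc b) zero _ gb gc agree inj rewrite gc =
  here (λ e → 0≢1+n (inj e))
    (tabulate-replace (f ∘ suc) (g ∘ suc) b refl gb
      (λ i i≢b → agree (suc i) (i≢b ∘ suc-injective) (λ ()))
      (λ i i≢b e → i≢b (suc-injective (inj e)))
      (λ i i≢b e → 0≢1+n (inj (sym e))))
tabulate-swap f g (suc b) (suc c) b≢c gb gc agree inj rewrite agree zero (λ ()) (λ ()) =
  there (tabulate-swap (f ∘ suc) (g ∘ suc) b c (b≢c ∘ cong suc) gb gc
    (λ i i≢b i≢c → agree (suc i) (i≢b ∘ suc-injective) (i≢c ∘ suc-injective))
    (suc-injective ∘ inj))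

-- Two permutations that agree at every position where neither takes the value B
-- are equal or differ by exchanging B with one other value; in the latter case
-- their parities are opposite.
agree-off-value : ∀ {k} (ρ ρ' : Permutation′ k) (B : Fin k) →
  (∀ i → ρ ⟨$⟩ʳ i ≡ ρ' ⟨$⟩ʳ i ⊎ ρ ⟨$⟩ʳ i ≡ B ⊎ ρ' ⟨$⟩ʳ i ≡ B) →
  ρ ≈ ρ' ⊎ parity ρ xor parity ρ' ≡ true
agree-off-value ρ ρ' B agree = cases (b ≟ c)
  where
  b c : Fin _
  b = ρ ⟨$⟩ˡ B
  c = ρ' ⟨$⟩ˡ B

  equal : b ≡ c → ρ ≈ ρ'
  equal b≡c i with i ≟ b | agree i
  ... | yes refl | _ = trans (inverseʳ ρ) (trans (sym (inverseʳ ρ')) (cong (ρ' ⟨$⟩ʳ_) (sym b≡c)))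
  ... | no _ | inj₁ e = e
  ... | no i≢b | inj₂ (inj₁ e) = ⊥-elim (i≢b (⟨$⟩ʳ≡⇒≡⟨$⟩ˡ ρ e))
  ... | no i≢b | inj₂ (inj₂ e) = ⊥-elim (i≢b (trans (⟨$⟩ʳ≡⇒≡⟨$⟩ˡ ρ' e) (sym b≡c)))

  f g : Fin _ → ℕ
  f i = toℕ (ρ ⟨$⟩ʳ i)
  g i = toℕ (ρ' ⟨$⟩ʳ i)

  -- Off b and c neither permutation takes the value B, so they agree there.
  elsewhere : ∀ i → i ≢ b → i ≢ c → g i ≡ f i
  elsewhere i i≢b i≢c with agree i
  ... | inj₁ e = cong toℕ (sym e)
  ... | inj₂ (inj₁ e) = ⊥-elim (i≢b (⟨$⟩ʳ≡⇒≡⟨$⟩ˡ ρ e))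
  ... | inj₂ (inj₂ e) = ⊥-elim (i≢c (⟨$⟩ʳ≡⇒≡⟨$⟩ˡ ρ' e))

  gc : g c ≡ f b
  gc = cong toℕ (trans (inverseʳ ρ') (sym (inverseʳ ρ)))

  ρc≢B : b ≢ c → ρ ⟨$⟩ʳ c ≢ B
  ρc≢B b≢c e = b≢c (sym (⟨$⟩ʳ≡⇒≡⟨$⟩ˡ ρ e))

  -- ρ' sends b to ρ c: the position j where ρ' takes the value ρ c ≠ B must be b.
  j : Fin _
  j = ρ' ⟨$⟩ˡ (ρ ⟨$⟩ʳ c)

  gb : b ≢ c → g b ≡ f c
  gb b≢c with agree j
  ... | inj₁ e = ⊥-elim (ρc≢B b≢c (begin
          ρ ⟨$⟩ʳ c    ≡⟨ sym (inverseʳ ρ') ⟩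
          ρ' ⟨$⟩ʳ j   ≡⟨ cong (ρ' ⟨$⟩ʳ_) (⟨$⟩ʳ-injective ρ (trans e (inverseʳ ρ'))) ⟩
          ρ' ⟨$⟩ʳ c   ≡⟨ inverseʳ ρ' ⟩
          B           ∎))
    where open ≡-Reasoning
  ... | inj₂ (inj₁ e) = cong toℕ (trans (cong (ρ' ⟨$⟩ʳ_) (sym (⟨$⟩ʳ≡⇒≡⟨$⟩ˡ ρ e))) (inverseʳ ρ'))
  ... | inj₂ (inj₂ e) = ⊥-elim (ρc≢B b≢c (trans (sym (inverseʳ ρ')) e))

  cases : Dec (b ≡ c) → ρ ≈ ρ' ⊎ parity ρ xor parity ρ' ≡ true
  cases (yes b≡c) = inj₁ (equal b≡c)
  cases (no b≢c) = inj₂ (swap-flips (tabulate-swap f g b c b≢c (gb b≢c) gc elsewhere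
                                       (⟨$⟩ʳ-injective ρ ∘ toℕ-injective)))

-- extend σ j : the permutation of Fin (1+k) acting as σ on positions 1..k
-- (shifted up by one) and then exchanging the values 0 and j.
extend : ∀ {k} → Permutation′ k → Fin (suc k) → Permutation′ (suc k)
extend σ j = lift₀ σ ∘ₚ transpose zero j

transpose-cases : ∀ {k} (i j y : Fin k) → PC.transpose i j y ≡ y ⊎ y ≡ i ⊎ PC.transpose i j y ≡ i
transpose-cases i j y with y ≟ i
... | yes y≡i = inj₂ (inj₁ y≡i)
... | no _ with y ≟ j
...   | yes refl = inj₂ (inj₂ refl)
...   | no _ = inj₁ refl

transpose-self : ∀ {k} (i y : Fin k) → PC.transpose i i y ≡ y
transpose-self i y with y ≟ i
... | yes y≡i = sym y≡i
... | no _ with y ≟ i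
...   | yes y≡i = sym y≡i
...   | no _ = refl

smallerParity-0 : ∀ l → smallerParity 0 l ≡ false
smallerParity-0 [] = refl
smallerParity-0 (y ∷ l) = smallerParity-0 l

smallerParity-map-suc : ∀ a l → smallerParity (suc a) (map suc l) ≡ smallerParity a l
smallerParity-map-suc a [] = refl
smallerParity-map-suc a (y ∷ l) = cong ((y <ᵇ a) xor_) (smallerParity-map-suc a l)

inversionParity-map-suc : ∀ l → inversionParity (map suc l) ≡ inversionParity l
inversionParity-map-suc [] = refl
inversionParity-map-suc (y ∷ l) = cong₂ _xor_ (smallerParity-map-suc y l) (inversionParity-map-suc l)

parity-lift₀ : ∀ {k} (σ : Permutation′ k) → parity (lift₀ σ) ≡ parity σ
parity-lift₀ σ = begin
  parity (lift₀ σ)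
    ≡⟨ cong (λ l → smallerParity 0 l xor inversionParity l) (sym (map-tabulate (λ i → toℕ (σ ⟨$⟩ʳ i)) suc)) ⟩
  smallerParity 0 (map suc (values σ)) xor inversionParity (map suc (values σ))
    ≡⟨ cong₂ _xor_ (smallerParity-0 (map suc (values σ))) (inversionParity-map-suc (values σ)) ⟩
  parity σ ∎
  where open ≡-Reasoning

isSuc : ∀ {k} → Fin k → Bool
isSuc zero = false
isSuc (suc _) = true

-- extend σ j has the parity of σ, flipped when j ≠ 0: then extend σ j differs from
-- lift₀ σ by the transposition of the values 0 and j.
parity-extend : ∀ {k} (σ : Permutation′ k) j → parity (extend σ j) ≡ isSuc j xor parity σ
parity-extend σ zero =
  trans (parity-cong {ρ = extend σ zero} {ρ' = lift₀ σ} (λ x → transpose-self zero (lift₀ σ ⟨$⟩ʳ x)))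
    (parity-lift₀ σ)
parity-extend σ (suc j)
  with agree-off-value (lift₀ σ) (extend σ (suc j)) zero (λ i → moved (lift₀ σ ⟨$⟩ʳ i))
  where
  moved : ∀ y → y ≡ PC.transpose zero (suc j) y ⊎ y ≡ zero ⊎ PC.transpose zero (suc j) y ≡ zero
  moved y = Sum.map₁ sym (transpose-cases zero (suc j) y)
... | inj₁ equal = ⊥-elim (0≢1+n (equal zero))
... | inj₂ flipped = begin
  parity (extend σ (suc j))  ≡⟨ flip (parity (lift₀ σ)) (parity (extend σ (suc j))) flipped ⟩
  true xor parity (lift₀ σ)  ≡⟨ cong (true xor_) (parity-lift₀ σ) ⟩
  true xor parity σ          ∎
  where
  open ≡-Reasoning
  flip : ∀ x y → x xor y ≡ true → y ≡ true xor x
  flip false false ()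
  flip false true _ = refl
  flip true false _ = refl
  flip true true ()

-- extend is injective: j is the value at position 0, and σ is what remains.
extend-injective : ∀ {k} (σ σ' : Permutation′ k) j j' → extend σ j ≈ extend σ' j' → j ≡ j' × σ ≈ σ'
extend-injective σ σ' j j' e with e zero
... | refl = refl , λ i → suc-injective (begin
  suc (σ ⟨$⟩ʳ i)                                          ≡⟨ sym (PC.transpose-inverse j zero) ⟩
  PC.transpose j zero (extend σ j ⟨$⟩ʳ suc i)              ≡⟨ cong (PC.transpose j zero) (e (suc i)) ⟩
  PC.transpose j zero (extend σ' j ⟨$⟩ʳ suc i)             ≡⟨ PC.transpose-inverse j zero ⟩
  suc (σ' ⟨$⟩ʳ i)                                         ∎)
  where open ≡-Reasoning

Fin1-unique : ∀ (x y : Fin 1) → x ≡ y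
Fin1-unique zero zero = refl

remQuot-injective : ∀ {m} n (c c' : Fin (m * n)) →
  quotient {m} n c ≡ quotient {m} n c' → remainder {m} n c ≡ remainder {m} n c' → c ≡ c'
remQuot-injective {m} n c c' q≡ r≡ =
  trans (sym (combine-remQuot {m} n c)) (trans (cong₂ combine q≡ r≡) (combine-remQuot {m} n c'))

-- Decoding all k! permutations of Fin k by repeated extend (a Lehmer code).
decode : (k : ℕ) → Fin (k !) → Permutation′ k
decode zero _ = id
decode (suc k) c = extend (decode k (remainder {suc k} (k !) c)) (quotient {suc k} (k !) c)

decode-injective : ∀ k c c' → decode k c ≈ decode k c' → c ≡ c'
decode-injective zero c c' _ = Fin1-unique c c'
decode-injective (suc k) c c' e with extend-injective _ _ _ _ e
... | j≡ , σ≈ = remQuot-injective {suc k} (k !) c c' j≡ (decode-injective k _ _ σ≈)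

-- (k+2)!/2 = (k+2)(k+1)⋯3, the number of permutations of Fin (k+2) of either parity.
halfFactorial : ℕ → ℕ
halfFactorial zero = 1
halfFactorial (suc k) = suc (suc (suc k)) * halfFactorial k

double-halfFactorial : ∀ k → 2 * halfFactorial k ≡ suc (suc k) !
double-halfFactorial zero = refl
double-halfFactorial (suc k) = begin
  2 * (k+3 * halfFactorial k)  ≡⟨ solve 2 (λ a h → con 2 :* (a :* h) := a :* (con 2 :* h)) refl k+3 (halfFactorial k) ⟩
  k+3 * (2 * halfFactorial k)  ≡⟨ cong (k+3 *_) (double-halfFactorial k) ⟩
  k+3 * (suc (suc k) !)        ∎
  where
  open ≡-Reasoning; open +-*-Solver
  k+3 = suc (suc (suc k))

-- Decoding (k+2)!/2 permutations of Fin (k+2) of prescribed parity b: as in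
-- decode, but the innermost step chooses the identity or the transposition of
-- 0 and 1 so as to reach parity b.
decodeWithParity : (k : ℕ) → Fin (halfFactorial k) → Bool → Permutation′ (suc (suc k))
decodeWithParity zero _ false = id
decodeWithParity zero _ true = transpose zero (suc zero)
decodeWithParity (suc k) c b =
  extend (decodeWithParity k (remainder {suc (suc (suc k))} (halfFactorial k) c) (b xor isSuc j)) j
  where j = quotient {suc (suc (suc k))} (halfFactorial k) c

parity-decodeWithParity : ∀ k c b → parity (decodeWithParity k c b) ≡ b
parity-decodeWithParity zero c false = refl
parity-decodeWithParity zero c true = refl
parity-decodeWithParity (suc k) c b = begin
  parity (extend σ j)          ≡⟨ parity-extend σ j ⟩
  isSuc j xor parity σ         ≡⟨ cong (isSuc j xor_) (parity-decodeWithParity k c' (b xor isSuc j)) ⟩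
  isSuc j xor (b xor isSuc j)  ≡⟨ solve 2 (λ J B → J :+ (B :+ J) := B) refl (isSuc j) b ⟩
  b                            ∎
  where
  open ≡-Reasoning; open xor-∧-Solver
  j = quotient {suc (suc (suc k))} (halfFactorial k) c
  c' = remainder {suc (suc (suc k))} (halfFactorial k) c
  σ = decodeWithParity k c' (b xor isSuc j)

decodeWithParity-injective : ∀ k c c' b b' → decodeWithParity k c b ≈ decodeWithParity k c' b' → c ≡ c'
decodeWithParity-injective zero c c' _ _ _ = Fin1-unique c c'
decodeWithParity-injective (suc k) c c' _ _ e with extend-injective _ _ _ _ e
... | j≡ , σ≈ = remQuot-injective {suc (suc (suc k))} (halfFactorial k) c c' j≡
                  (decodeWithParity-injective k _ _ _ _ σ≈)

encode : ∀ {n} → Permutation′ n → Fin (n !)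
encode {zero} _ = zero
encode {suc n} π = combine (π ⟨$⟩ʳ zero) (encode (remove zero π))

encode-injective : ∀ {n} (π σ : Permutation′ n) → encode π ≡ encode σ → π ≈ σ
encode-injective {zero} π σ _ ()
encode-injective {suc n} π σ e with combine-injective _ _ _ _ e
... | π0≡σ0 , rest≡ = λ
  { zero → π0≡σ0
  ; (suc i) → begin
      π ⟨$⟩ʳ suc i
        ≡⟨ punchIn-permute π zero i ⟩
      punchIn (π ⟨$⟩ʳ zero) (remove zero π ⟨$⟩ʳ i)
        ≡⟨ cong₂ punchIn π0≡σ0 (encode-injective (remove zero π) (remove zero σ) rest≡ i) ⟩
      punchIn (σ ⟨$⟩ʳ zero) (remove zero σ ⟨$⟩ʳ i)
        ≡⟨ sym (punchIn-permute σ zero i) ⟩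
      σ ⟨$⟩ʳ suc i ∎ }
  where open ≡-Reasoning

-- Fin n splits into its ⌈n/2⌉ even and ⌊n/2⌋ odd values:
-- evenOdd n (inj₁ r) = 2r and evenOdd n (inj₂ q) = 2q+1.
evenOdd : ∀ n → Fin ⌈ n /2⌉ ⊎ Fin ⌊ n /2⌋ → Fin n
evenOdd (suc n) (inj₁ zero) = zero
evenOdd (suc n) (inj₁ (suc r)) = suc (evenOdd n (inj₂ r))
evenOdd (suc n) (inj₂ q) = suc (evenOdd n (inj₁ q))

evenOdd⁻¹ : ∀ n → Fin n → Fin ⌈ n /2⌉ ⊎ Fin ⌊ n /2⌋
evenOdd⁻¹ (suc n) zero = inj₁ zero
evenOdd⁻¹ (suc n) (suc v) = Sum.[ inj₂ , inj₁ ∘ suc ] (evenOdd⁻¹ n v)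

evenOdd-evenOdd⁻¹ : ∀ n v → evenOdd n (evenOdd⁻¹ n v) ≡ v
evenOdd-evenOdd⁻¹ (suc n) zero = refl
evenOdd-evenOdd⁻¹ (suc n) (suc v) with evenOdd⁻¹ n v | evenOdd-evenOdd⁻¹ n v
... | inj₁ _ | e = cong suc e
... | inj₂ _ | e = cong suc e

evenOdd⁻¹-evenOdd : ∀ n w → evenOdd⁻¹ n (evenOdd n w) ≡ w
evenOdd⁻¹-evenOdd (suc n) (inj₁ zero) = refl
evenOdd⁻¹-evenOdd (suc n) (inj₁ (suc r)) rewrite evenOdd⁻¹-evenOdd n (inj₂ r) = refl
evenOdd⁻¹-evenOdd (suc n) (inj₂ q) rewrite evenOdd⁻¹-evenOdd n (inj₁ q) = refl

evenOdd↔ : ∀ n → (Fin ⌈ n /2⌉ ⊎ Fin ⌊ n /2⌋) ↔ Fin n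
evenOdd↔ n = mk↔ₛ′ (evenOdd n) (evenOdd⁻¹ n) (evenOdd-evenOdd⁻¹ n) (evenOdd⁻¹-evenOdd n)

mutual
  evenOdd-even : ∀ n r → toℕ (evenOdd n (inj₁ r)) ≡ 2 * toℕ r
  evenOdd-even (suc n) zero = refl
  evenOdd-even (suc n) (suc r) = trans (cong suc (evenOdd-odd n r)) (sym (*-suc 2 (toℕ r)))

  evenOdd-odd : ∀ n q → toℕ (evenOdd n (inj₂ q)) ≡ suc (2 * toℕ q)
  evenOdd-odd (suc n) q = cong suc (evenOdd-even n q)

evenOdd-far-even : ∀ n {a b} → a ≢ b →
  Even⁺ ∣ toℕ (evenOdd n (inj₁ a)) - toℕ (evenOdd n (inj₁ b)) ∣
evenOdd-far-even n {a} {b} a≢b rewrite evenOdd-even n a | evenOdd-even n b =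
  even⁺-double-distance (a≢b ∘ toℕ-injective)

evenOdd-far-odd : ∀ n {a b} → a ≢ b →
  Even⁺ ∣ toℕ (evenOdd n (inj₂ a)) - toℕ (evenOdd n (inj₂ b)) ∣
evenOdd-far-odd n {a} {b} a≢b rewrite evenOdd-odd n a | evenOdd-odd n b =
  even⁺-double-distance (a≢b ∘ toℕ-injective)

agree-off-zero : ∀ {k} (σ σ' : Permutation′ (suc k)) →
  (∀ j → σ ⟨$⟩ʳ suc j ≡ σ' ⟨$⟩ʳ suc j) → σ ≈ σ'
agree-off-zero σ σ' agree (suc j) = agree j
agree-off-zero σ σ' agree zero with σ ⟨$⟩ˡ (σ' ⟨$⟩ʳ zero) in e
... | zero = trans (cong (σ ⟨$⟩ʳ_) (sym e)) (inverseʳ σ)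
... | suc j = ⊥-elim (0≢1+n (⟨$⟩ʳ-injective σ' (trans (sym σ1+j≡σ'0) (agree j))))
  where
  σ1+j≡σ'0 : σ ⟨$⟩ʳ suc j ≡ σ' ⟨$⟩ʳ zero
  σ1+j≡σ'0 = trans (cong (σ ⟨$⟩ʳ_) (sym e)) (inverseʳ σ)

_⊎↔_ : {A B C D : Set} → A ↔ B → C ↔ D → (A ⊎ C) ↔ (B ⊎ D)
f ⊎↔ g = mk↔ₛ′ (Sum.map (Inverse.to f) (Inverse.to g)) (Sum.map (Inverse.from f) (Inverse.from g))
  (λ { (inj₁ b) → cong inj₁ (Inverse.strictlyInverseˡ f b)
     ; (inj₂ d) → cong inj₂ (Inverse.strictlyInverseˡ g d) })
  (λ { (inj₁ a) → cong inj₁ (Inverse.strictlyInverseʳ f a)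
     ; (inj₂ c) → cong inj₂ (Inverse.strictlyInverseʳ g c) })

shiftFirst : ∀ {o m} → (Fin o ⊎ Fin (suc m)) ↔ (Fin (suc o) ⊎ Fin m)
shiftFirst = mk↔ₛ′ forward backward
  (λ { (inj₁ zero) → refl ; (inj₁ (suc r)) → refl ; (inj₂ j) → refl })
  (λ { (inj₁ r) → refl ; (inj₂ zero) → refl ; (inj₂ (suc j)) → refl })
  where
  forward : ∀ {o m} → Fin o ⊎ Fin (suc m) → Fin (suc o) ⊎ Fin m
  forward (inj₁ r) = inj₁ (suc r)
  forward (inj₂ zero) = inj₁ zero
  forward (inj₂ (suc j)) = inj₂ j
  backward : ∀ {o m} → Fin (suc o) ⊎ Fin m → Fin o ⊎ Fin (suc m)
  backward (inj₁ zero) = inj₂ zero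
  backward (inj₁ (suc r)) = inj₁ r
  backward (inj₂ j) = inj₂ (suc j)

-- The construction works for any labelling of Fin n by a left block of o labels
-- and a right block of 1+m labels such that distinct labels of the same block
-- carry values an even positive distance apart (even and odd values, for instance).
module LowerBoundFamily {n o m : ℕ} (label : (Fin o ⊎ Fin (suc m)) ↔ Fin n)
  (far-left : ∀ {a b} → a ≢ b →
     Even⁺ ∣ toℕ (Inverse.to label (inj₁ a)) - toℕ (Inverse.to label (inj₁ b)) ∣)
  (far-right : ∀ {a b} → a ≢ b →
     Even⁺ ∣ toℕ (Inverse.to label (inj₂ a)) - toℕ (Inverse.to label (inj₂ b)) ∣)
  where

  Label : Set
  Label = Fin o ⊎ Fin (suc m)

  Far : Label → Label → Set
  Far w w' = Even⁺ ∣ toℕ (Inverse.to label w) - toℕ (Inverse.to label w') ∣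

  -- On labels: ρ permutes the left labels together with the first right label
  -- (put in front as slot 0), and then σ permutes the right labels.
  core : Permutation′ (suc m) → Permutation′ (suc o) → Label ↔ Label
  core σ ρ = (↔-id _ ⊎↔ σ) ↔-∘ (↔-sym shiftFirst ↔-∘ ((ρ ⊎↔ ↔-id _) ↔-∘ shiftFirst))

  member : Permutation′ (suc m) → Permutation′ (suc o) → Permutation′ n
  member σ ρ = label ↔-∘ (core σ ρ ↔-∘ ↔-sym label)

  onSlots : Permutation′ (suc m) → Permutation′ (suc o) → Fin (suc o) ⊎ Fin m → Label
  onSlots σ ρ z = Inverse.to (↔-id _ ⊎↔ σ) (Inverse.from shiftFirst (Inverse.to (ρ ⊎↔ ↔-id _) z))

  -- The final label of slot u of the ρ-block: σ of the first right label for
  -- slot 0, the left label x for slot 1+x.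
  slot : Permutation′ (suc m) → Fin (suc o) → Label
  slot σ u = Inverse.to (↔-id _ ⊎↔ σ) (Inverse.from shiftFirst (inj₁ u))

  close-slots : ∀ σ σ' u u' → ¬ Far (slot σ u) (slot σ' u') → u ≡ u' ⊎ u ≡ zero ⊎ u' ≡ zero
  close-slots σ σ' zero u' _ = inj₂ (inj₁ refl)
  close-slots σ σ' (suc x) zero _ = inj₂ (inj₂ refl)
  close-slots σ σ' (suc x) (suc y) ¬far with x ≟ y
  ... | yes x≡y = inj₁ (cong suc x≡y)
  ... | no x≢y = ⊥-elim (¬far (far-left x≢y))

  module Close (σ σ' : Permutation′ (suc m)) (ρ ρ' : Permutation′ (suc o))
    (close : ∀ s → ¬ Even⁺ ∣ toℕ (member σ ρ ⟨$⟩ʳ s) - toℕ (member σ' ρ' ⟨$⟩ʳ s) ∣) where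

    close-at : ∀ w → ¬ Far (Inverse.to (core σ ρ) w) (Inverse.to (core σ' ρ') w)
    close-at w = subst (λ z → ¬ Far (Inverse.to (core σ ρ) z) (Inverse.to (core σ' ρ') z))
      (Inverse.strictlyInverseʳ label w) (close (Inverse.to label w))

    -- The right labels other than the first are moved by σ alone, so σ ≈ σ'.
    σ≈σ' : σ ≈ σ'
    σ≈σ' = agree-off-zero σ σ' agree
      where
      agree : ∀ j → σ ⟨$⟩ʳ suc j ≡ σ' ⟨$⟩ʳ suc j
      agree j with σ ⟨$⟩ʳ suc j ≟ σ' ⟨$⟩ʳ suc j
      ... | yes e = e
      ... | no σj≢σ'j = ⊥-elim (close-at (inj₂ (suc j)) (far-right σj≢σ'j))

    ρ-agree-off-0 : ∀ a → ρ ⟨$⟩ʳ a ≡ ρ' ⟨$⟩ʳ a ⊎ ρ ⟨$⟩ʳ a ≡ zero ⊎ ρ' ⟨$⟩ʳ a ≡ zero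
    ρ-agree-off-0 a = close-slots σ σ' (ρ ⟨$⟩ʳ a) (ρ' ⟨$⟩ʳ a)
      (subst (λ z → ¬ Far (onSlots σ ρ z) (onSlots σ' ρ' z))
             (Inverse.strictlyInverseˡ shiftFirst (inj₁ a)) (close-at (Inverse.from shiftFirst (inj₁ a))))

    equal : parity ρ ≡ parity ρ' → σ ≈ σ' × ρ ≈ ρ'
    equal same with agree-off-value ρ ρ' zero ρ-agree-off-0
    ... | inj₁ ρ≈ρ' = σ≈σ' , ρ≈ρ'
    ... | inj₂ flipped with trans (sym flipped) (trans (cong (_xor parity ρ') same) (xor-same (parity ρ')))
    ...   | ()

  member-GDifferent : ∀ σ σ' ρ ρ' → parity ρ ≡ parity ρ' → ¬ (σ ≈ σ' × ρ ≈ ρ') →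
    GDifferent n Even⁺ (member σ ρ) (member σ' ρ')
  member-GDifferent σ σ' ρ ρ' same distinct
    with any? (λ s → even⁺? ∣ toℕ (member σ ρ ⟨$⟩ʳ s) - toℕ (member σ' ρ' ⟨$⟩ʳ s) ∣)
  ... | yes witness = witness
  ... | no none = ⊥-elim (distinct (Close.equal σ σ' ρ ρ' (λ s far → none (s , far)) same))

flipIf : Fin 2 → Fin 2 → Fin 2
flipIf zero i = i
flipIf (suc zero) zero = suc zero
flipIf (suc zero) (suc zero) = zero

flipIf-involutive : ∀ b i → flipIf b (flipIf b i) ≡ i
flipIf-involutive zero i = refl
flipIf-involutive (suc zero) zero = refl
flipIf-involutive (suc zero) (suc zero) = refl

-- A code s ∈ Fin (2^⌊n/2⌋) lists one bit per pair {2q, 2q+1}; pairSwap n s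
-- exchanges the two elements of each pair whose bit is set.
pairSwap : ∀ n → Fin (2 ^ ⌊ n /2⌋) → Fin n → Fin n
pairSwap (suc (suc n)) s zero = flipIf (quotient {2} (2 ^ ⌊ n /2⌋) s) zero ↑ˡ n
pairSwap (suc (suc n)) s (suc zero) = flipIf (quotient {2} (2 ^ ⌊ n /2⌋) s) (suc zero) ↑ˡ n
pairSwap (suc (suc n)) s (suc (suc v)) = suc (suc (pairSwap n (remainder {2} (2 ^ ⌊ n /2⌋) s) v))
pairSwap (suc zero) s zero = zero

pairSwap-first : ∀ n s (i : Fin 2) →
  pairSwap (suc (suc n)) s (i ↑ˡ n) ≡ flipIf (quotient {2} (2 ^ ⌊ n /2⌋) s) i ↑ˡ n
pairSwap-first n s zero = refl
pairSwap-first n s (suc zero) = refl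

pairSwap-first-involutive : ∀ n s (i : Fin 2) →
  pairSwap (suc (suc n)) s (pairSwap (suc (suc n)) s (i ↑ˡ n)) ≡ i ↑ˡ n
pairSwap-first-involutive n s i = begin
  swap (swap (i ↑ˡ n))          ≡⟨ cong swap (pairSwap-first n s i) ⟩
  swap (flipIf b i ↑ˡ n)        ≡⟨ pairSwap-first n s (flipIf b i) ⟩
  flipIf b (flipIf b i) ↑ˡ n    ≡⟨ cong (_↑ˡ n) (flipIf-involutive b i) ⟩
  i ↑ˡ n                        ∎
  where
  open ≡-Reasoning
  swap = pairSwap (suc (suc n)) s
  b = quotient {2} (2 ^ ⌊ n /2⌋) s

pairSwap-involutive : ∀ n s v → pairSwap n s (pairSwap n s v) ≡ v
pairSwap-involutive (suc (suc n)) s zero = pairSwap-first-involutive n s zero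
pairSwap-involutive (suc (suc n)) s (suc zero) = pairSwap-first-involutive n s (suc zero)
pairSwap-involutive (suc (suc n)) s (suc (suc v)) = cong (λ x → suc (suc x)) (pairSwap-involutive n _ v)
pairSwap-involutive (suc zero) s zero = refl

pairSwapₚ : ∀ n → Fin (2 ^ ⌊ n /2⌋) → Permutation′ n
pairSwapₚ n s = mk↔ₛ′ (pairSwap n s) (pairSwap n s) (pairSwap-involutive n s) (pairSwap-involutive n s)

first-pair : ∀ n (i : Fin 2) → ⌊ toℕ (i ↑ˡ n) /2⌋ ≡ 0
first-pair n zero = refl
first-pair n (suc zero) = refl

pairSwap-pair : ∀ n s v → ⌊ toℕ (pairSwap n s v) /2⌋ ≡ ⌊ toℕ v /2⌋
pairSwap-pair (suc (suc n)) s zero = first-pair n (flipIf (quotient {2} (2 ^ ⌊ n /2⌋) s) zero)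
pairSwap-pair (suc (suc n)) s (suc zero) =
  first-pair n (flipIf (quotient {2} (2 ^ ⌊ n /2⌋) s) (suc zero))
pairSwap-pair (suc (suc n)) s (suc (suc v)) = cong suc (pairSwap-pair n _ v)
pairSwap-pair (suc zero) s zero = refl

-- The code can be read off from pairSwap: the first bit from the image of 0.
pairSwap-injective : ∀ n s s' → (∀ v → pairSwap n s v ≡ pairSwap n s' v) → s ≡ s'
pairSwap-injective zero s s' _ = Fin1-unique s s'
pairSwap-injective (suc zero) s s' _ = Fin1-unique s s'
pairSwap-injective (suc (suc n)) s s' e =
  remQuot-injective {2} (2 ^ ⌊ n /2⌋) s s' (first-bit _ _ (e zero))
    (pairSwap-injective n _ _ (λ v → suc-injective (suc-injective (e (suc (suc v))))))
  where
  first-bit : ∀ b b' → flipIf b zero ↑ˡ n ≡ flipIf b' zero ↑ˡ n → b ≡ b'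
  first-bit zero zero _ = refl
  first-bit (suc zero) (suc zero) _ = refl
  first-bit zero (suc zero) ()
  first-bit (suc zero) zero ()

-- If π followed by pairSwap s equals π' followed by pairSwap s', then at every
-- position the values of π and π' lie in the same pair, so π and π' are not
-- G(2ℕ)-different.
pairSwap-¬GDifferent : ∀ n (π π' : Permutation′ n) s s' →
  (π ∘ₚ pairSwapₚ n s) ≈ (π' ∘ₚ pairSwapₚ n s') → ¬ GDifferent n Even⁺ π π'
pairSwap-¬GDifferent n π π' s s' e (p , far) = same-pair⇒¬even⁺ _ _ (begin
  ⌊ toℕ (π ⟨$⟩ʳ p) /2⌋                  ≡⟨ sym (pairSwap-pair n s (π ⟨$⟩ʳ p)) ⟩
  ⌊ toℕ (pairSwap n s (π ⟨$⟩ʳ p)) /2⌋    ≡⟨ cong (λ v → ⌊ toℕ v /2⌋) (e p) ⟩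
  ⌊ toℕ (pairSwap n s' (π' ⟨$⟩ʳ p)) /2⌋  ≡⟨ pairSwap-pair n s' (π' ⟨$⟩ʳ p) ⟩
  ⌊ toℕ (π' ⟨$⟩ʳ p) /2⌋                 ∎) far
  where open ≡-Reasoning

pairSwap-cancel : ∀ n (π : Permutation′ n) s s' →
  (π ∘ₚ pairSwapₚ n s) ≈ (π ∘ₚ pairSwapₚ n s') → s ≡ s'
pairSwap-cancel n π s s' e = pairSwap-injective n s s' λ v → begin
  pairSwap n s v                        ≡⟨ cong (pairSwap n s) (sym (inverseʳ π)) ⟩
  pairSwap n s (π ⟨$⟩ʳ (π ⟨$⟩ˡ v))       ≡⟨ e (π ⟨$⟩ˡ v) ⟩
  pairSwap n s' (π ⟨$⟩ʳ (π ⟨$⟩ˡ v))      ≡⟨ cong (pairSwap n s') (inverseʳ π) ⟩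
  pairSwap n s' v                       ∎
  where open ≡-Reasoning

All-lookup : ∀ {A : Set} {P : A → Set} {xs : List A} → All P xs → ∀ i → P (lookup xs i)
All-lookup (p ∷ _) zero = p
All-lookup (_ ∷ ps) (suc i) = All-lookup ps i

AllPairs-lookup : ∀ {A : Set} {R : A → A → Set} {xs : List A} → AllPairs R xs →
  ∀ {i j} → i ≢ j → R (lookup xs i) (lookup xs j) ⊎ R (lookup xs j) (lookup xs i)
AllPairs-lookup (_ ∷ _) {zero} {zero} i≢j = ⊥-elim (i≢j refl)
AllPairs-lookup (r ∷ _) {zero} {suc j} _ = inj₁ (All-lookup r j)
AllPairs-lookup (r ∷ _) {suc i} {zero} _ = inj₂ (All-lookup r i)
AllPairs-lookup (_ ∷ rs) {suc i} {suc j} i≢j = AllPairs-lookup rs (i≢j ∘ cong suc)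

-- Upper bound: the permutations π followed by pairSwap s, for π in the family
-- and s ∈ Fin (2^⌊n/2⌋), are pairwise distinct permutations of Fin n.
upper-bound : ∀ n (ps : List (Permutation′ n)) → GDFamily n Even⁺ ps →
  length ps * 2 ^ ⌊ n /2⌋ ≤ n !
upper-bound n ps family = injective⇒≤ {f = encode ∘ shifted} (shifted-injective ∘ encode-injective _ _)
  where
  S = 2 ^ ⌊ n /2⌋

  shifted : Fin (length ps * S) → Permutation′ n
  shifted x = lookup ps (quotient S x) ∘ₚ pairSwapₚ n (remainder {length ps} S x)

  shifted-injective : ∀ {x y} → shifted x ≈ shifted y → x ≡ y
  shifted-injective {x} {y} e = cases (i ≟ j)
    where
    i j : Fin (length ps)
    i = quotient S x
    j = quotient S y
    s s' : Fin S
    s = remainder {length ps} S x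
    s' = remainder {length ps} S y

    cases : Dec (i ≡ j) → x ≡ y
    cases (yes i≡j) = remQuot-injective S x y i≡j (pairSwap-cancel n (lookup ps i) s s'
      (subst (λ k → shifted x ≈ (lookup ps k ∘ₚ pairSwapₚ n s')) (sym i≡j) e))
    cases (no i≢j) = ⊥-elim (Sum.[ pairSwap-¬GDifferent n (lookup ps i) (lookup ps j) s s' e
                                 , pairSwap-¬GDifferent n (lookup ps j) (lookup ps i) s' s (sym ∘ e) ]′
                                 (AllPairs-lookup family i≢j))

binomial-factorials : ∀ n k → k ≤ n → (n C k) * (k ! * (n ∸ k) !) ≡ n !
binomial-factorials n k k≤n = trans (cong (_* (k ! * (n ∸ k) !)) (nCk≡n!/k![n-k]! k≤n))
  (m/n*n≡m {{k !* (n ∸ k) !≢0}} (k![n∸k]!∣n! k≤n))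

family-size : ∀ a b → (a + suc b) ! * (suc b + 1) ≡ 2 * ((a + suc b) C a) * (a ! * halfFactorial b)
family-size a b = begin
  N ! * (suc b + 1)
    ≡⟨ cong (_* (suc b + 1)) (sym binomial) ⟩
  c * (a ! * suc b !) * (suc b + 1)
    ≡⟨ solve 4 (λ c x y p → c :* (x :* y) :* (p :+ con 1) := c :* x :* ((con 1 :+ p) :* y))
         refl c (a !) (suc b !) (suc b) ⟩
  c * a ! * (suc (suc b) !)
    ≡⟨ cong (c * a ! *_) (sym (double-halfFactorial b)) ⟩
  c * a ! * (2 * halfFactorial b)
    ≡⟨ solve 3 (λ c x h → c :* x :* (con 2 :* h) := con 2 :* c :* (x :* h)) refl c (a !) (halfFactorial b) ⟩
  2 * c * (a ! * halfFactorial b) ∎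
  where
  open ≡-Reasoning; open +-*-Solver
  N = a + suc b
  c = N C a
  binomial : c * (a ! * suc b !) ≡ N !
  binomial = subst (λ d → c * (a ! * d !) ≡ N !) (m+n∸m≡n a (suc b))
    (binomial-factorials N a (m≤m+n a (suc b)))

-- For n = 2+k: a G(2ℕ)-family of ⌊n/2⌋! · (⌈n/2⌉+1)!/2 permutations, indexed by a
-- permutation σ of the odd values and an even permutation ρ of slot 0 and the even values.
large-family : ∀ k → Σ (List (Permutation′ (suc (suc k)))) λ ps →
  GDFamily (suc (suc k)) Even⁺ ps × length ps ≡ suc ⌊ k /2⌋ ! * halfFactorial ⌈ k /2⌉
large-family k = tabulate member′ , tabulate⁺ distinct , length-tabulate member′
  where
  n = suc (suc k)
  H = halfFactorial ⌈ k /2⌉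
  open LowerBoundFamily (evenOdd↔ n) (evenOdd-far-even n) (evenOdd-far-odd n)

  odd-part : Fin (suc ⌊ k /2⌋ ! * H) → Permutation′ (suc ⌊ k /2⌋)
  odd-part x = decode (suc ⌊ k /2⌋) (quotient H x)

  even-part : Fin (suc ⌊ k /2⌋ ! * H) → Permutation′ (suc (suc ⌈ k /2⌉))
  even-part x = decodeWithParity ⌈ k /2⌉ (remainder {suc ⌊ k /2⌋ !} H x) false

  member′ : Fin (suc ⌊ k /2⌋ ! * H) → Permutation′ n
  member′ x = member (odd-part x) (even-part x)

  distinct : ∀ {x y} → x ≢ y → GDifferent n Even⁺ (member′ x) (member′ y)
  distinct {x} {y} x≢y = member-GDifferent (odd-part x) (odd-part y) (even-part x) (even-part y)
    (trans (parity-decodeWithParity ⌈ k /2⌉ (remainder {suc ⌊ k /2⌋ !} H x) false)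
      (sym (parity-decodeWithParity ⌈ k /2⌉ (remainder {suc ⌊ k /2⌋ !} H y) false)))
    λ (σ≈σ' , ρ≈ρ') → x≢y (remQuot-injective H x y (decode-injective _ _ _ σ≈σ')
                                                   (decodeWithParity-injective _ _ _ _ _ ρ≈ρ'))

lower-bound : ∀ n t → ((ps : List (Permutation′ n)) → GDFamily n Even⁺ ps → length ps ≤ t) →
  n ! * (⌈ n /2⌉ + 1) ≤ 2 * (n C ⌊ n /2⌋) * t
lower-bound zero t bounded = ≤-trans (bounded (id ∷ []) ([] ∷ [])) (m≤m+n t (t + 0))
lower-bound (suc zero) t bounded = *-monoʳ-≤ 2 (bounded (id ∷ []) ([] ∷ []))
lower-bound (suc (suc k)) t bounded with large-family k
... | ps , family , |ps|≡ = begin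
  n ! * (⌈ n /2⌉ + 1)                ≡⟨ counting ⟩
  2 * (n C ⌊ n /2⌋) * size           ≡⟨ cong (2 * (n C ⌊ n /2⌋) *_) (sym |ps|≡) ⟩
  2 * (n C ⌊ n /2⌋) * length ps      ≤⟨ *-monoʳ-≤ (2 * (n C ⌊ n /2⌋)) (bounded ps family) ⟩
  2 * (n C ⌊ n /2⌋) * t              ∎
  where
  open ≤-Reasoning
  n = suc (suc k)
  size = ⌊ n /2⌋ ! * halfFactorial ⌈ k /2⌉
  counting : n ! * (⌈ n /2⌉ + 1) ≡ 2 * (n C ⌊ n /2⌋) * size
  counting = subst (λ N → N ! * (⌈ n /2⌉ + 1) ≡ 2 * (N C ⌊ n /2⌋) * size) (⌊n/2⌋+⌈n/2⌉≡n n)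
    (family-size ⌊ n /2⌋ ⌈ k /2⌉)

proposition2 : (n : ℕ) → .{{_ : NonZero n}} → (t : ℕ) → IsT n Even⁺ t →
    ((n !) * (⌈ n /2⌉ + 1) ≤ 2 * (n C ⌊ n /2⌋) * t) × (t * 2 ^ ⌊ n /2⌋ ≤ n !)
proposition2 n t ((ps , family , |ps|≡t) , maximal) =
  lower-bound n t maximal , subst (λ l → l * 2 ^ ⌊ n /2⌋ ≤ n !) |ps|≡t (upper-bound n ps family)
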